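{- Let $V_1,\ldots,V_n$ be pairwise disjoint sets with $|V_i|=n$ for all $i\in\{1,\ldots,n\}$, let $\Omega\subseteq V_1\times\cdots\times V_n$ be an octahedral system, and let $V_i$ be a class covered in $\Omega$. If $\Omega=\triangle_{U\in\mathcal D}U$ for some set $\mathcal D$ of umbrellas none of which has colour $V_i$, then $|\Omega|\geq n^2$.
   Context: An octahedral system is a set $\Omega\subseteq V_1\times\cdots\times V_n$ such that $|\Omega\cap(X_1\times\cdots\times X_n)|$ is even whenever $X_i\subseteq V_i$ and $|X_i|=2$ for all $i$. The $V_i$ are called classes. A class $V_i$ is covered in $\Omega$ if for every $x\in V_i$ there is an element of $\Omega$ whose $i$th component is $x$. An umbrella is a set $\{x^{(1)}\}\times\cdots\times\{x^{(i-1)}\}\times V_i\times\{x^{(i+1)}\}\times\cdots\times\{x^{(n)}\}$ with $x^{(j)}\in V_j$ for $j\neq i$; $V_i$ is its colour. $\triangle_{U\in\mathcal D}U$ is the set of elements belonging to an odd number of members of $\mathcal D$. -}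

module Defs where

open import Data.Nat using (ℕ; zero; suc)
open import Data.Bool using (Bool; true; false; _∧_; _∨_; _xor_; if_then_else_)
open import Data.Fin using (Fin)
open import Data.Fin.Properties using (_≟_)
open import Data.Fin.Subset using (Subset; ∣_∣)
open import Data.Vec using (Vec; []; _∷_; lookup)
open import Data.List using (List; []; _∷_; concatMap; map; foldr; allFin)
open import Data.Bool.ListAction using (and)
open import Data.List.Relation.Unary.AllPairs using (AllPairs)
open import Data.Product using (_×_; _,_; ∃)
open import Relation.Binary.PropositionalEquality using (_≡_)
open import Relation.Nullary using (¬_)
open import Relation.Nullary.Decidable using (⌊_⌋)
open import Data.Nat.Divisibility using (_∣_)

-- Classes V_1..V_n: each a (tagged, hence pairwise disjoint) copy of Fin n.
-- An element of V_1 × ... × V_n is a vector of length n over Fin n.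
Point : ℕ → Set
Point n = Vec (Fin n) n

allVecs : (k m : ℕ) → List (Vec (Fin k) m)
allVecs k zero = [] ∷ []
allVecs k (suc m) = concatMap (λ a → map (a ∷_) (allVecs k m)) (allFin k)

count : {A : Set} → (A → Bool) → List A → ℕ
count p [] = zero
count p (x ∷ xs) = if p x then suc (count p xs) else count p xs

Family : ℕ → Set
Family n = Point n → Bool

card : {n : ℕ} → Family n → ℕ
card {n} Ω = count Ω (allVecs n n)

inProd : {n : ℕ} → (Fin n → Subset n) → Point n → Bool
inProd {n} X v = and (map (λ i → lookup (X i) (lookup v i)) (allFin n))

Octahedral : {n : ℕ} → Family n → Set
Octahedral {n} Ω =
  (X : Fin n → Subset n) → (∀ i → ∣ X i ∣ ≡ 2) →
  2 ∣ count (λ v → Ω v ∧ inProd X v) (allVecs n n)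

Covered : {n : ℕ} → Family n → Fin n → Set
Covered {n} Ω i = (x : Fin n) → ∃ λ (v : Point n) → (Ω v ≡ true) × (lookup v i ≡ x)

-- An umbrella is presented by its colour j and a point x; it is the set
-- {x_1} × ... × V_j × ... × {x_n} (the j-th coordinate of x is ignored).
Umbrella : ℕ → Set
Umbrella n = Fin n × Point n

colour : {n : ℕ} → Umbrella n → Fin n
colour (j , _) = j

inUmb : {n : ℕ} → Umbrella n → Point n → Bool
inUmb {n} (j , x) v = and (map (λ k → ⌊ k ≟ j ⌋ ∨ ⌊ lookup v k ≟ lookup x k ⌋) (allFin n))

SameUmbrella : {n : ℕ} → Umbrella n → Umbrella n → Set
SameUmbrella {n} u u' = (v : Point n) → inUmb u v ≡ inUmb u' v

DistinctUmbrellas : {n : ℕ} → List (Umbrella n) → Set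
DistinctUmbrellas = AllPairs (λ u u' → ¬ SameUmbrella u u')

symDiff : {n : ℕ} → List (Umbrella n) → Family n
symDiff D v = foldr (λ u b → inUmb u v xor b) false D

module Submission where

-- Work in the grid Fin k ^ m (words of length m over Fin k)
-- with umbrellas of any colour, and read a list D of umbrellas as the
-- symmetric difference of its members.  The key fact (weight-bound) is:
--
--   if D has no umbrella of colour i and the symmetric difference of D
--   meets the hyperplane {v | v_i = x}, then it has at least k points
--   there; likewise without any hyperplane restriction.
--
-- It is proved by induction on m, splitting words by their first letter t.
-- On the hyperplane {v₀ = t}, an umbrella of colour 0 leaves one point (the
-- same for every t), and one of another colour leaves either nothing or an
-- umbrella of dimension m ('section').  If every first-letter slice is hit,
-- there are k nonempty slices; if slice s is empty, then slice t differs
-- from it only by the sections at t and s, so induction applies to those.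
-- The theorem follows by double counting over the n hyperplanes
-- {v_i = x}: coverage makes each of them nonempty, so each has ≥ n points.

open import Defs
open import Data.Bool using (Bool; true; false; _∧_; _∨_; _xor_; if_then_else_)
open import Data.Bool.ListAction using (and)
open import Data.Bool.Properties using (∧-zeroʳ; ∧-identityʳ; xor-assoc; xor-comm; xor-same; xor-identityʳ)
open import Data.Fin using (Fin; zero; suc)
open import Data.Fin.Properties using (_≟_; any?)
open import Data.List using (List; []; _∷_; _++_; map; tabulate; concatMap; foldr; allFin)
open import Data.List.Properties using (map-tabulate; tabulate-cong)
open import Data.List.Relation.Unary.All using (All; []; _∷_; universal)
open import Data.List.Relation.Unary.All.Properties using (++⁺)
open import Data.Nat using (ℕ; zero; suc; _+_; _*_; _≤_; z≤n; s≤s)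
open import Data.Nat.Properties using (≤-trans; ≤-reflexive; +-mono-≤; m≤m+n; +-suc; *-identityʳ; n≢0⇒n>0; module ≤-Reasoning)
import Data.Nat.Properties as ℕ
open import Algebra.Properties.CommutativeMonoid.Sum ℕ.+-0-commutativeMonoid
  using (sum; sum-cong-≗; sum-remove; sum-replicate-zero)
open import Data.Product using (_×_; _,_; proj₁)
open import Data.Unit using (⊤)
open import Data.Vec using (Vec; []; _∷_; lookup)
open import Relation.Nullary using (yes; no)
open import Relation.Nullary.Decidable using (⌊_⌋; dec-true; isYes≗does; ⌊⌋-map′)
open import Relation.Binary.PropositionalEquality using (_≡_; _≢_; refl; sym; trans; cong; cong₂; subst; module ≡-Reasoning)

summand≤sum : {k : ℕ} (c : Fin k → ℕ) (t : Fin k) → c t ≤ sum c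
summand≤sum {suc k} c t = ≤-trans (m≤m+n (c t) _) (≤-reflexive (sym (sum-remove {i = t} c)))

sum-lower : {k : ℕ} (b : ℕ) (c : Fin k → ℕ) → (∀ t → b ≤ c t) → k * b ≤ sum c
sum-lower {zero} b c lo = z≤n
sum-lower {suc k} b c lo = +-mono-≤ (lo zero) (sum-lower b (λ t → c (suc t)) (λ t → lo (suc t)))

sum-bump : {k : ℕ} (a : Fin k) (c : Fin k → ℕ) →
  sum (λ x → if ⌊ a ≟ x ⌋ then suc (c x) else c x) ≡ suc (sum c)
sum-bump zero c = refl
sum-bump (suc a) c = trans (cong (c zero +_) (trans bumped (sum-bump a (λ t → c (suc t))))) (+-suc (c zero) _)
  where
  bumped : sum (λ t → if ⌊ suc a ≟ suc t ⌋ then suc (c (suc t)) else c (suc t))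
         ≡ sum (λ t → if ⌊ a ≟ t ⌋ then suc (c (suc t)) else c (suc t))
  bumped = sum-cong-≗ (λ t → cong (λ b → if b then suc (c (suc t)) else c (suc t)) (⌊⌋-map′ _ _ (a ≟ t)))

⌊≟⌋-true : {k : ℕ} {x y : Fin k} → x ≡ y → ⌊ x ≟ y ⌋ ≡ true
⌊≟⌋-true {x = x} {y} eq = trans (isYes≗does (x ≟ y)) (dec-true (x ≟ y) eq)

count-++ : {A : Set} (p : A → Bool) (xs ys : List A) → count p (xs ++ ys) ≡ count p xs + count p ys
count-++ p [] ys = refl
count-++ p (x ∷ xs) ys with p x
... | true = cong suc (count-++ p xs ys)
... | false = count-++ p xs ys

count-map : {A B : Set} (p : B → Bool) (f : A → B) (xs : List A) → count p (map f xs) ≡ count (λ a → p (f a)) xs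
count-map p f [] = refl
count-map p f (x ∷ xs) with p (f x)
... | true = cong suc (count-map p f xs)
... | false = count-map p f xs

count-cong : {A : Set} (p q : A → Bool) (xs : List A) → (∀ a → p a ≡ q a) → count p xs ≡ count q xs
count-cong p q [] e = refl
count-cong p q (x ∷ xs) e rewrite e x with q x
... | true = cong suc (count-cong p q xs e)
... | false = count-cong p q xs e

count-by-class : {A : Set} {k : ℕ} (p : A → Bool) (f : A → Fin k) (L : List A) →
  count p L ≡ sum (λ x → count (λ a → p a ∧ ⌊ f a ≟ x ⌋) L)
count-by-class {k = k} p f [] = sym (sum-replicate-zero k)
count-by-class p f (a ∷ L) with p a
... | false = count-by-class p f L
... | true = trans (cong suc (count-by-class p f L)) (sym (sum-bump (f a) _))

count-concatMap : {A : Set} {k n : ℕ} (p : A → Bool) (h : Fin k → List A) (g : Fin n → Fin k) →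
  count p (concatMap h (tabulate g)) ≡ sum (λ t → count p (h (g t)))
count-concatMap {n = zero} p h g = refl
count-concatMap {n = suc n} p h g =
  trans (count-++ p (h (g zero)) _) (cong (count p (h (g zero)) +_) (count-concatMap p h (λ t → g (suc t))))

count-allVecs : {k m : ℕ} (p : Vec (Fin k) (suc m) → Bool) →
  count p (allVecs k (suc m)) ≡ sum (λ t → count (λ y → p (t ∷ y)) (allVecs k m))
count-allVecs {k} {m} p =
  trans (count-concatMap p (λ a → map (a ∷_) (allVecs k m)) (λ t → t))
        (sum-cong-≗ (λ t → count-map p (t ∷_) (allVecs k m)))

count-firstLetter≤ : {k m : ℕ} (p : Vec (Fin k) (suc m) → Bool) (t : Fin k) →
  count (λ y → p (t ∷ y)) (allVecs k m) ≤ count p (allVecs k (suc m))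
count-firstLetter≤ p t = ≤-trans (summand≤sum _ t) (≤-reflexive (sym (count-allVecs p)))

count-witness : {k : ℕ} (m : ℕ) (p : Vec (Fin k) m → Bool) (y : Vec (Fin k) m) →
  p y ≡ true → 1 ≤ count p (allVecs k m)
count-witness zero p [] py rewrite py = s≤s z≤n
count-witness (suc m) p (t ∷ y) py = ≤-trans (count-witness m (λ z → p (t ∷ z)) y py) (count-firstLetter≤ p t)

count-zero : {k m : ℕ} (p : Vec (Fin k) m → Bool) → count p (allVecs k m) ≡ 0 → ∀ y → p y ≡ false
count-zero {m = m} p none y with p y in py
... | false = refl
... | true with subst (1 ≤_) none (count-witness m p y py)
...   | ()

xor-swap : ∀ a b c → a xor (b xor c) ≡ b xor (a xor c)
xor-swap false b c = refl
xor-swap true false c = refl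
xor-swap true true c = refl

xor-cancel : ∀ a b p → (a xor p) xor (b xor p) ≡ a xor b
xor-cancel a b p = begin
  (a xor p) xor (b xor p)  ≡⟨ xor-assoc a p (b xor p) ⟩
  a xor (p xor (b xor p))  ≡⟨ cong (λ c → a xor (p xor c)) (xor-comm b p) ⟩
  a xor (p xor (p xor b))  ≡⟨ cong (a xor_) (sym (xor-assoc p p b)) ⟩
  a xor ((p xor p) xor b)  ≡⟨ cong (λ c → a xor (c xor b)) (xor-same p) ⟩
  a xor b                  ∎
  where open ≡-Reasoning

-- Umbrellas in the grid Fin k ^ m.  For k = m = n these are exactly the
-- umbrellas of Defs, and xorSum is symDiff.

Grid : ℕ → ℕ → Set
Grid k m = Vec (Fin k) m

Umb : ℕ → ℕ → Set
Umb k m = Fin m × Grid k m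

member : {k m : ℕ} → Umb k m → Grid k m → Bool
member {m = m} (j , x) v = and (map (λ c → ⌊ c ≟ j ⌋ ∨ ⌊ lookup v c ≟ lookup x c ⌋) (allFin m))

xorSum : {k m : ℕ} → List (Umb k m) → Grid k m → Bool
xorSum D v = foldr (λ u b → member u v xor b) false D

xorSum-++ : {k m : ℕ} (A B : List (Umb k m)) (y : Grid k m) → xorSum (A ++ B) y ≡ xorSum A y xor xorSum B y
xorSum-++ [] B y = refl
xorSum-++ (u ∷ A) B y = trans (cong (member u y xor_) (xorSum-++ A B y)) (sym (xor-assoc (member u y) _ _))

agrees : {k m : ℕ} → Grid k m → Grid k m → Bool
agrees y x = and (tabulate (λ c → ⌊ lookup y c ≟ lookup x c ⌋))

member-colour0 : {k m : ℕ} (x₀ t : Fin k) (xs y : Grid k m) → member (zero , x₀ ∷ xs) (t ∷ y) ≡ agrees y xs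
member-colour0 {m = m} x₀ t xs y = cong and (map-tabulate {n = m} (λ (c : Fin m) → suc c) _)

member-colourSuc : {k m : ℕ} (c : Fin m) (x₀ t : Fin k) (xs y : Grid k m) →
  member (suc c , x₀ ∷ xs) (t ∷ y) ≡ ⌊ t ≟ x₀ ⌋ ∧ member (c , xs) y
member-colourSuc {m = m} c x₀ t xs y = cong (⌊ t ≟ x₀ ⌋ ∧_) (cong and (begin
  map (λ d → ⌊ d ≟ suc c ⌋ ∨ agree (t ∷ y) (x₀ ∷ xs) d) (tabulate suc)
    ≡⟨ map-tabulate suc _ ⟩
  tabulate (λ d → ⌊ suc d ≟ suc c ⌋ ∨ agree y xs d)
    ≡⟨ tabulate-cong (λ d → cong (_∨ agree y xs d) (⌊⌋-map′ _ _ (d ≟ c))) ⟩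
  tabulate (λ d → ⌊ d ≟ c ⌋ ∨ agree y xs d)
    ≡⟨ sym (map-tabulate (λ d → d) _) ⟩
  map (λ d → ⌊ d ≟ c ⌋ ∨ agree y xs d) (allFin m) ∎))
  where
  open ≡-Reasoning
  agree : {n : ℕ} → Grid _ n → Grid _ n → Fin n → Bool
  agree v w d = ⌊ lookup v d ≟ lookup w d ⌋

pointPart : {k m : ℕ} → List (Umb k (suc m)) → Grid k m → Bool
pointPart [] y = false
pointPart ((zero , _ ∷ xs) ∷ D) y = agrees y xs xor pointPart D y
pointPart ((suc _ , _) ∷ D) y = pointPart D y

section : {k m : ℕ} → List (Umb k (suc m)) → Fin k → List (Umb k m)
section [] t = []
section ((zero , _) ∷ D) t = section D t
section ((suc c , x₀ ∷ xs) ∷ D) t = if ⌊ t ≟ x₀ ⌋ then (c , xs) ∷ section D t else section D t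

xorSum-head : {k m : ℕ} (D : List (Umb k (suc m))) (t : Fin k) (y : Grid k m) →
  xorSum D (t ∷ y) ≡ xorSum (section D t) y xor pointPart D y
xorSum-head [] t y = refl
xorSum-head ((zero , x₀ ∷ xs) ∷ D) t y
  rewrite member-colour0 x₀ t xs y | xorSum-head D t y = xor-swap (agrees y xs) (xorSum (section D t) y) (pointPart D y)
xorSum-head ((suc c , x₀ ∷ xs) ∷ D) t y rewrite member-colourSuc c x₀ t xs y | xorSum-head D t y with ⌊ t ≟ x₀ ⌋
... | true = sym (xor-assoc (member (c , xs) y) _ _)
... | false = refl

head-difference : {k m : ℕ} (D : List (Umb k (suc m))) (t s : Fin k) (y : Grid k m) →
  xorSum D (t ∷ y) xor xorSum D (s ∷ y) ≡ xorSum (section D t ++ section D s) y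
head-difference D t s y = begin
  xorSum D (t ∷ y) xor xorSum D (s ∷ y)
    ≡⟨ cong₂ _xor_ (xorSum-head D t y) (xorSum-head D s y) ⟩
  (xorSum (section D t) y xor pointPart D y) xor (xorSum (section D s) y xor pointPart D y)
    ≡⟨ xor-cancel (xorSum (section D t) y) (xorSum (section D s) y) (pointPart D y) ⟩
  xorSum (section D t) y xor xorSum (section D s) y
    ≡⟨ sym (xorSum-++ (section D t) (section D s) y) ⟩
  xorSum (section D t ++ section D s) y ∎
  where open ≡-Reasoning

data Region (k m : ℕ) : Set where
  whole      : Region k m
  hyperplane : Fin m → Fin k → Region k m

inRegion : {k m : ℕ} → Region k m → Grid k m → Bool
inRegion whole v = true
inRegion (hyperplane i x) v = ⌊ lookup v i ≟ x ⌋

Transverse : {k m : ℕ} → Region k m → Umb k m → Set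
Transverse whole u = ⊤
Transverse (hyperplane i x) u = proj₁ u ≢ i

widen : {k m : ℕ} → Region k m → Region k (suc m)
widen whole = whole
widen (hyperplane i x) = hyperplane (suc i) x

inRegion-widen : {k m : ℕ} (ρ : Region k m) (t : Fin k) (y : Grid k m) → inRegion (widen ρ) (t ∷ y) ≡ inRegion ρ y
inRegion-widen whole t y = refl
inRegion-widen (hyperplane i x) t y = refl

section-transverse : {k m : ℕ} (ρ : Region k m) (D : List (Umb k (suc m))) (t : Fin k) →
  All (Transverse (widen ρ)) D → All (Transverse ρ) (section D t)
section-transverse whole D t tr = universal _ _
section-transverse (hyperplane i x) [] t [] = []
section-transverse (hyperplane i x) ((zero , _) ∷ D) t (_ ∷ tr) = section-transverse (hyperplane i x) D t tr
section-transverse (hyperplane i x) ((suc c , x₀ ∷ xs) ∷ D) t (c≢i ∷ tr) with ⌊ t ≟ x₀ ⌋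
... | true = (λ c≡i → c≢i (cong suc c≡i)) ∷ section-transverse (hyperplane i x) D t tr
... | false = section-transverse (hyperplane i x) D t tr

pointPart-vanishes : {k m : ℕ} (x : Fin k) (D : List (Umb k (suc m))) →
  All (Transverse (hyperplane zero x)) D → (y : Grid k m) → pointPart D y ≡ false
pointPart-vanishes x [] [] y = refl
pointPart-vanishes x ((zero , _) ∷ D) (0≢0 ∷ _) y with 0≢0 refl
... | ()
pointPart-vanishes x ((suc c , _) ∷ D) (_ ∷ tr) y = pointPart-vanishes x D tr y

inside : {k m : ℕ} → List (Umb k m) → Region k m → Grid k m → Bool
inside D ρ v = xorSum D v ∧ inRegion ρ v

weight : {k m : ℕ} → List (Umb k m) → Region k m → ℕ
weight {k} {m} D ρ = count (inside D ρ) (allVecs k m)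

inside-cong : {k m : ℕ} (ρ : Region k m) (f g : Grid k m → Bool) →
  (∀ y → inRegion ρ y ≡ true → f y ≡ g y) → ∀ y → f y ∧ inRegion ρ y ≡ g y ∧ inRegion ρ y
inside-cong ρ f g agree y with inRegion ρ y in inρ
... | false = trans (∧-zeroʳ (f y)) (sym (∧-zeroʳ (g y)))
... | true = cong (_∧ true) (agree y inρ)

sliceWeight : {k m : ℕ} → List (Umb k (suc m)) → Region k m → Fin k → ℕ
sliceWeight {k} {m} D ρ t = count (λ y → xorSum D (t ∷ y) ∧ inRegion ρ y) (allVecs k m)

weight-widen : {k m : ℕ} (D : List (Umb k (suc m))) (ρ : Region k m) → weight D (widen ρ) ≡ sum (sliceWeight D ρ)
weight-widen {k} {m} D ρ = trans (count-allVecs (inside D (widen ρ)))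
  (sum-cong-≗ (λ t → count-cong _ _ (allVecs k m) (λ y → cong (xorSum D (t ∷ y) ∧_) (inRegion-widen ρ t y))))

weight-bound : {k m : ℕ} (ρ : Region k m) (D : List (Umb k m)) → All (Transverse ρ) D →
  (v : Grid k m) → inside D ρ v ≡ true → k ≤ weight D ρ

weight-bound-widen : {k m : ℕ} (ρ : Region k m) (D : List (Umb k (suc m))) → All (Transverse (widen ρ)) D →
  (v : Grid k (suc m)) → inside D (widen ρ) v ≡ true → k ≤ weight D (widen ρ)
weight-bound-widen {k} ρ D tr (t₀ ∷ y₀) hit with any? (λ t → sliceWeight D ρ t ℕ.≟ 0)
... | no noSliceEmpty = begin
  k                        ≡⟨ sym (*-identityʳ k) ⟩
  k * 1                    ≤⟨ sum-lower 1 (sliceWeight D ρ) (λ t → n≢0⇒n>0 (λ empty → noSliceEmpty (t , empty))) ⟩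
  sum (sliceWeight D ρ)    ≡⟨ sym (weight-widen D ρ) ⟩
  weight D (widen ρ)       ∎
  where open ≤-Reasoning
... | yes (s , sliceEmpty) = begin
  k                        ≤⟨ weight-bound ρ D′ tr′ y₀ hit′ ⟩
  weight D′ ρ              ≡⟨ count-cong _ _ (allVecs _ _) (λ y → sym (inside-cong ρ (λ y → xorSum D (t₀ ∷ y)) (xorSum D′) sliceₜ₀≡D′ y)) ⟩
  sliceWeight D ρ t₀       ≤⟨ summand≤sum (sliceWeight D ρ) t₀ ⟩
  sum (sliceWeight D ρ)    ≡⟨ sym (weight-widen D ρ) ⟩
  weight D (widen ρ)       ∎
  where
  open ≤-Reasoning
  D′ : List (Umb _ _)
  D′ = section D t₀ ++ section D s
  tr′ : All (Transverse ρ) D′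
  tr′ = ++⁺ (section-transverse ρ D t₀ tr) (section-transverse ρ D s tr)
  sliceₛ-empty : ∀ y → inRegion ρ y ≡ true → xorSum D (s ∷ y) ≡ false
  sliceₛ-empty y inρ = trans (sym (∧-identityʳ _))
    (subst (λ b → xorSum D (s ∷ y) ∧ b ≡ false) inρ (count-zero _ sliceEmpty y))
  -- on ρ the slice at t₀ is the slice at t₀ minus the empty slice at s
  sliceₜ₀≡D′ : ∀ y → inRegion ρ y ≡ true → xorSum D (t₀ ∷ y) ≡ xorSum D′ y
  sliceₜ₀≡D′ y inρ = trans (sym (xor-identityʳ _))
    (trans (cong (xorSum D (t₀ ∷ y) xor_) (sym (sliceₛ-empty y inρ))) (head-difference D t₀ s y))
  hit′ : inside D′ ρ y₀ ≡ true
  hit′ = trans (sym (inside-cong ρ _ _ sliceₜ₀≡D′ y₀))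
    (trans (cong (xorSum D (t₀ ∷ y₀) ∧_) (sym (inRegion-widen ρ t₀ y₀))) hit)

-- Base of the hyperplane case: on {v₀ = x}, D is its section at x.
weight-bound-hyperplane0 : {k m : ℕ} (x : Fin k) (D : List (Umb k (suc m))) →
  All (Transverse (hyperplane zero x)) D →
  (v : Grid k (suc m)) → inside D (hyperplane zero x) v ≡ true → k ≤ weight D (hyperplane zero x)
weight-bound-hyperplane0 x D tr (t₀ ∷ y₀) hit with t₀ ≟ x
... | no _ with trans (sym (∧-zeroʳ _)) hit
...   | ()
weight-bound-hyperplane0 {k} {m} x D tr (x ∷ y₀) hit | yes refl = begin
  k
    ≤⟨ weight-bound whole (section D x) (universal _ _) y₀ hit′ ⟩
  weight (section D x) whole
    ≡⟨ count-cong _ _ (allVecs k m) onHyperplane ⟩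
  count (λ y → inside D (hyperplane zero x) (x ∷ y)) (allVecs k m)
    ≤⟨ count-firstLetter≤ (inside D (hyperplane zero x)) x ⟩
  weight D (hyperplane zero x) ∎
  where
  open ≤-Reasoning
  section≡ : ∀ y → xorSum (section D x) y ≡ xorSum D (x ∷ y)
  section≡ y = sym (trans (xorSum-head D x y)
    (trans (cong (xorSum (section D x) y xor_) (pointPart-vanishes x D tr y)) (xor-identityʳ _)))
  onHyperplane : ∀ y → inside (section D x) whole y ≡ inside D (hyperplane zero x) (x ∷ y)
  onHyperplane y = cong₂ _∧_ (section≡ y) (sym (⌊≟⌋-true refl))
  hit′ : inside (section D x) whole y₀ ≡ true
  hit′ = trans (cong (_∧ true) (section≡ y₀)) hit

weight-bound {m = zero} ρ [] [] [] ()
weight-bound {m = zero} ρ ((() , _) ∷ D) tr v hit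
weight-bound {m = suc m} whole D = weight-bound-widen whole D
weight-bound {m = suc m} (hyperplane zero x) D = weight-bound-hyperplane0 x D
weight-bound {m = suc m} (hyperplane (suc i) x) D = weight-bound-widen (hyperplane i x) D

proposition3 : (n : ℕ) (Ω : Family n) (i : Fin n) → Octahedral Ω → Covered Ω i →
    (D : List (Umbrella n)) → DistinctUmbrellas D → All (λ u → colour u ≢ i) D →
    ((v : Point n) → Ω v ≡ symDiff D v) → n * n ≤ card Ω
proposition3 n Ω i _ covered D _ noColour-i Ω≡△D = begin
  n * n                                   ≤⟨ sum-lower n (λ x → weight D (hyperplane i x)) hyperplane-full ⟩
  sum (λ x → weight D (hyperplane i x))   ≡⟨ sym (count-by-class (xorSum D) (λ v → lookup v i) (allVecs n n)) ⟩
  count (xorSum D) (allVecs n n)          ≡⟨ sym (count-cong Ω (xorSum D) (allVecs n n) Ω≡△D) ⟩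
  card Ω                                  ∎
  where
  open ≤-Reasoning
  hyperplane-full : ∀ x → n ≤ weight D (hyperplane i x)
  hyperplane-full x with covered x
  ... | v , Ωv , vᵢ≡x =
    weight-bound (hyperplane i x) D noColour-i v (cong₂ _∧_ (trans (sym (Ω≡△D v)) Ωv) (⌊≟⌋-true vᵢ≡x))
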